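{- Let $(X,1,\curlywedge)$ be a meet-semilattice and define $s(x,p)=p\cap{\uparrow}x$ for $x\in X$ and filters $p$. Then $s$ is a selection function on $(X,1,\curlywedge)$ if and only if $(X,1,\curlywedge)$ is distributive.
   Context: In a meet-semilattice $(X,1,\curlywedge)$ with top $1$, $x\preccurlyeq y$ iff $x\curlywedge y=x$, and ${\uparrow}x=\{y:x\preccurlyeq y\}$. A filter is an upward closed subset closed under finite meets; $\mathcal F(X)$ is the set of filters. A selection function is a map $s:X\times\mathcal F(X)\to\mathcal F(X)$ such that for all $x,y,z\in X$ and filters $a$: $s(1,a)=\{1\}$; $x\preccurlyeq y$ implies $s(y,a)\subseteq s(x,a)$; if $z\in s(x\curlywedge y,a)$ there exist $u\in s(x,a)$, $v\in s(y,a)$ with $u\curlywedge v\preccurlyeq z$. The semilattice is distributive if whenever $x\curlywedge y\preccurlyeq z$ there exist $u,v\in X$ with $x\preccurlyeq u$, $y\preccurlyeq v$ and $z=u\curlywedge v$. -}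

module Defs where

open import Level using (Level; _⊔_; suc)
open import Data.Product using (Σ; ∃; ∃-syntax; _×_; _,_)
open import Relation.Binary.PropositionalEquality using (_≡_)
open import Function.Bundles using (_⇔_)

record MeetSemilatticeTop (c : Level) : Set (suc c) where
  infixr 7 _⋏_
  infix 4 _≼_
  field
    X      : Set c
    𝟙      : X
    _⋏_    : X → X → X
    assoc  : ∀ x y z → (x ⋏ y) ⋏ z ≡ x ⋏ (y ⋏ z)
    comm   : ∀ x y → x ⋏ y ≡ y ⋏ x
    idem   : ∀ x → x ⋏ x ≡ x
    identʳ : ∀ x → x ⋏ 𝟙 ≡ x

  _≼_ : X → X → Set c
  x ≼ y = x ⋏ y ≡ x

  Subset : (ℓ : Level) → Set (c ⊔ suc ℓ)
  Subset ℓ = X → Set ℓ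

  _⊆_ : ∀ {ℓ₁ ℓ₂} → Subset ℓ₁ → Subset ℓ₂ → Set (c ⊔ ℓ₁ ⊔ ℓ₂)
  A ⊆ B = ∀ {x} → A x → B x

  _≐_ : ∀ {ℓ₁ ℓ₂} → Subset ℓ₁ → Subset ℓ₂ → Set (c ⊔ ℓ₁ ⊔ ℓ₂)
  A ≐ B = A ⊆ B × B ⊆ A

  _∩_ : ∀ {ℓ₁ ℓ₂} → Subset ℓ₁ → Subset ℓ₂ → Subset (ℓ₁ ⊔ ℓ₂)
  (A ∩ B) x = A x × B x

  ⟦_⟧ : X → Subset c
  ⟦ y ⟧ x = x ≡ y

  ↑ : X → Subset c
  ↑ x y = x ≼ y

  record IsFilter {ℓ} (F : Subset ℓ) : Set (c ⊔ ℓ) where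
    field
      has-𝟙   : F 𝟙
      up      : ∀ {x y} → x ≼ y → F x → F y
      meet    : ∀ {x y} → F x → F y → F (x ⋏ y)

  Filter : (ℓ : Level) → Set (c ⊔ suc ℓ)
  Filter ℓ = Σ (Subset ℓ) IsFilter

  -- A selection function s : X × 𝓕(X) → 𝓕(X) (given here by its underlying
  -- subsets; filterhood of the values is required separately)
  record IsSelectionFunction {ℓ ℓ'} (s : X → Filter ℓ → Subset ℓ') : Set (c ⊔ suc ℓ ⊔ ℓ') where
    field
      values-filters : ∀ x a → IsFilter (s x a)
      top      : ∀ a → s 𝟙 a ≐ ⟦ 𝟙 ⟧
      antitone : ∀ {x y} a → x ≼ y → s y a ⊆ s x a
      split    : ∀ x y z a → s (x ⋏ y) a z →
                 ∃[ u ] ∃[ v ] (s x a u × s y a v × (u ⋏ v) ≼ z)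

  IsDistributive : Set c
  IsDistributive = ∀ x y z → (x ⋏ y) ≼ z →
    ∃[ u ] ∃[ v ] (x ≼ u × y ≼ v × z ≡ u ⋏ v)

  sel : ∀ {ℓ} → X → Filter ℓ → Subset (c ⊔ ℓ)
  sel x (p , _) = p ∩ ↑ x

-- Forward: apply the splitting axiom to the principal filter ↑z at z itself; the
-- resulting u ∈ ↑x ∩ ↑z and v ∈ ↑y ∩ ↑z satisfy z ≼ u ⋏ v ≼ z.
-- Backward: distributivity writes z as u ⋏ v with x ≼ u and y ≼ v, and u, v lie
-- in every filter containing z because they lie above z.
module Submission where

open import Defs
open import Level using (Level)
open import Function.Bundles using (_⇔_; mk⇔)
open import Data.Product using (∃-syntax; _×_; _,_)
open import Relation.Binary.PropositionalEquality
  using (_≡_; refl; sym; trans; cong; module ≡-Reasoning)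

module MeetSemilatticeTopProperties {c : Level} (L : MeetSemilatticeTop c) where
  open MeetSemilatticeTop L
  open IsFilter
  open ≡-Reasoning

  ≼-trans : ∀ {x y z} → x ≼ y → y ≼ z → x ≼ z
  ≼-trans {x} {y} {z} x≼y y≼z = begin
    x ⋏ z        ≡⟨ cong (_⋏ z) (sym x≼y) ⟩
    (x ⋏ y) ⋏ z  ≡⟨ assoc x y z ⟩
    x ⋏ (y ⋏ z)  ≡⟨ cong (x ⋏_) y≼z ⟩
    x ⋏ y        ≡⟨ x≼y ⟩
    x            ∎

  ≼-antisym : ∀ {x y} → x ≼ y → y ≼ x → x ≡ y
  ≼-antisym {x} {y} x≼y y≼x = trans (sym x≼y) (trans (comm x y) y≼x)

  ⋏-greatest : ∀ {x y z} → x ≼ y → x ≼ z → x ≼ y ⋏ z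
  ⋏-greatest {x} {y} {z} x≼y x≼z = begin
    x ⋏ (y ⋏ z)  ≡⟨ sym (assoc x y z) ⟩
    (x ⋏ y) ⋏ z  ≡⟨ cong (_⋏ z) x≼y ⟩
    x ⋏ z        ≡⟨ x≼z ⟩
    x            ∎

  x⋏y≼x : ∀ x y → x ⋏ y ≼ x
  x⋏y≼x x y = begin
    (x ⋏ y) ⋏ x  ≡⟨ assoc x y x ⟩
    x ⋏ (y ⋏ x)  ≡⟨ cong (x ⋏_) (comm y x) ⟩
    x ⋏ (x ⋏ y)  ≡⟨ sym (assoc x x y) ⟩
    (x ⋏ x) ⋏ y  ≡⟨ cong (_⋏ y) (idem x) ⟩
    x ⋏ y        ∎

  x⋏y≼y : ∀ x y → x ⋏ y ≼ y
  x⋏y≼y x y = trans (assoc x y y) (cong (x ⋏_) (idem y))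

  ≼-𝟙 : ∀ x → x ≼ 𝟙
  ≼-𝟙 = identʳ

  ↑-isFilter : ∀ x → IsFilter (↑ x)
  ↑-isFilter x = record
    { has-𝟙 = ≼-𝟙 x
    ; up    = λ y≼z x≼y → ≼-trans x≼y y≼z
    ; meet  = ⋏-greatest
    }

  ∩-isFilter : ∀ {ℓ₁ ℓ₂} {A : Subset ℓ₁} {B : Subset ℓ₂} →
               IsFilter A → IsFilter B → IsFilter (A ∩ B)
  ∩-isFilter fA fB = record
    { has-𝟙 = has-𝟙 fA , has-𝟙 fB
    ; up    = λ x≼y (ax , bx) → up fA x≼y ax , up fB x≼y bx
    ; meet  = λ (ax , bx) (ay , by) → meet fA ax ay , meet fB bx by
    }

  filter-⋏ˡ : ∀ {ℓ} {F : Subset ℓ} → IsFilter F → ∀ {x y} → F (x ⋏ y) → F x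
  filter-⋏ˡ fF = up fF (x⋏y≼x _ _)

  filter-⋏ʳ : ∀ {ℓ} {F : Subset ℓ} → IsFilter F → ∀ {x y} → F (x ⋏ y) → F y
  filter-⋏ʳ fF = up fF (x⋏y≼y _ _)

  module _ {ℓ : Level} where

    sel-isFilter : ∀ x (a : Filter ℓ) → IsFilter (sel x a)
    sel-isFilter x (_ , fp) = ∩-isFilter fp (↑-isFilter x)

    sel-𝟙 : ∀ (a : Filter ℓ) → sel 𝟙 a ≐ ⟦ 𝟙 ⟧
    sel-𝟙 (_ , fp) = (λ { {z} (_ , 𝟙≼z) → ≼-antisym (≼-𝟙 z) 𝟙≼z })
                   , (λ { refl → has-𝟙 fp , idem 𝟙 })

    sel-antitone : ∀ {x y} (a : Filter ℓ) → x ≼ y → sel y a ⊆ sel x a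
    sel-antitone _ x≼y (pz , y≼z) = pz , ≼-trans x≼y y≼z

    sel-split : IsDistributive → ∀ x y z (a : Filter ℓ) → sel (x ⋏ y) a z →
                ∃[ u ] ∃[ v ] (sel x a u × sel y a v × u ⋏ v ≼ z)
    sel-split distrib x y z (_ , fp) (pz , x⋏y≼z) with distrib x y z x⋏y≼z
    ... | u , v , x≼u , y≼v , refl =
      u , v , (filter-⋏ˡ fp pz , x≼u) , (filter-⋏ʳ fp pz , y≼v) , idem (u ⋏ v)

  sel-isSelectionFunction : IsDistributive → IsSelectionFunction (sel {c})
  sel-isSelectionFunction distrib = record
    { values-filters = sel-isFilter
    ; top            = sel-𝟙
    ; antitone       = sel-antitone
    ; split          = sel-split distrib
    }

  sel-isSelectionFunction⇒isDistributive :
    IsSelectionFunction (sel {c}) → IsDistributive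
  sel-isSelectionFunction⇒isDistributive S x y z x⋏y≼z
    with IsSelectionFunction.split S x y z (↑ z , ↑-isFilter z) (idem z , x⋏y≼z)
  ... | u , v , (z≼u , x≼u) , (z≼v , y≼v) , u⋏v≼z =
    u , v , x≼u , y≼v , ≼-antisym (⋏-greatest z≼u z≼v) u⋏v≼z

open MeetSemilatticeTopProperties

lemma5p19 : ∀ {c : Level} (L : MeetSemilatticeTop c) →
    let open MeetSemilatticeTop L in
    IsSelectionFunction (sel {c}) ⇔ IsDistributive
lemma5p19 L = mk⇔ (sel-isSelectionFunction⇒isDistributive L) (sel-isSelectionFunction L)
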